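{- For each integer $n\ge 2$, let $M(n)$ be the minimum, over all forcibly connected graphical degree sequences $d_1\ge d_2\ge\cdots\ge d_n$ of length $n$, of the largest term $d_1$. Then $M(n)=\Omega(\sqrt{n})$, i.e., there is a constant $c>0$ such that $M(n)>c\sqrt{n}$ for all sufficiently large $n$.
   Context: A graphical degree sequence of length $n$ is a non-increasing sequence of $n$ non-negative integers that is the degree sequence of some simple graph on $n$ vertices (a realization). It is forcibly connected if every realization of it is connected. -}

module Defs where

open import Data.Nat using (ℕ; zero; suc; _+_; _*_; _≤_; _<_; _≥_)
open import Data.Fin using (Fin; zero; suc; _≤_)
open import Data.Bool using (Bool; true; false; if_then_else_)
open import Data.List using (List; map; allFin)
open import Data.Nat.ListAction using (sum)
open import Data.Product using (Σ; ∃; _×_; _,_)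
open import Relation.Binary.PropositionalEquality using (_≡_)

record SimpleGraph (n : ℕ) : Set where
  field
    Adj   : Fin n → Fin n → Bool
    sym   : ∀ u v → Adj u v ≡ Adj v u
    irrefl : ∀ v → Adj v v ≡ false
open SimpleGraph public

degree : ∀ {n} → SimpleGraph n → Fin n → ℕ
degree {n} G v = sum (map (λ w → if Adj G v w then 1 else 0) (allFin n))

data Reach {n : ℕ} (G : SimpleGraph n) (u : Fin n) : Fin n → Set where
  here : Reach G u u
  step : ∀ {v w} → Reach G u v → Adj G v w ≡ true → Reach G u w

Connected : ∀ {n} → SimpleGraph n → Set
Connected {n} G = ∀ (u v : Fin n) → Reach G u v

NonIncreasing : ∀ {n} → (Fin n → ℕ) → Set
NonIncreasing {n} d = ∀ (i j : Fin n) → i Data.Fin.≤ j → d j Data.Nat.≤ d i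

Realizes : ∀ {n} → SimpleGraph n → (Fin n → ℕ) → Set
Realizes {n} G d = ∀ (i : Fin n) → degree G i ≡ d i

Graphical : ∀ {n} → (Fin n → ℕ) → Set
Graphical {n} d = NonIncreasing d × Σ (SimpleGraph n) (λ G → Realizes G d)

ForciblyConnected : ∀ {n} → (Fin n → ℕ) → Set
ForciblyConnected {n} d = ∀ (G : SimpleGraph n) → Realizes G d → Connected G

-- Write Δ = d₁; every entry is positive since d is forcibly connected. If Δ² ≤ n, the samples of d
-- at positions 0, Δ, 2Δ, …, Δ² are Δ + 1 values in [1, Δ], so two consecutive samples agree and,
-- d being non-increasing, some k ≤ Δ occurs at k + 1 consecutive positions: a set S of k + 1
-- vertices of degree k. If moreover n > 4(Δ + 1)², every realization in which two vertices
-- s₁, s₂ ∈ S are non-adjacent can be improved. Each sᵢ has a neighbour tᵢ ∉ S, and counting gives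
-- an edge xy avoiding S, t₁, t₂ and the neighbourhoods of t₁, t₂, s₁; the 2-switches
-- t₁s₁, xy ↦ t₁x, s₁y and s₁y, s₂t₂ ↦ s₁s₂, yt₂ keep all degrees and all edges inside S and add
-- s₁s₂. So some realization makes S a clique, which is then a connected component with fewer than
-- n vertices. Hence n ≤ 4(Δ + 1)² ≤ 16Δ², i.e. d₁ > √(n / 17).

module Submission where

open import Defs hiding (sym)
open import Data.Nat using (ℕ; zero; suc; _+_; _*_; _^_; _≤_; _<_; z≤n; s≤s; _<?_)
open import Data.Nat.Properties hiding (_≟_; suc-injective)
import Data.Nat as ℕ
import Data.Nat.ListAction as List
open import Data.Nat.Induction using (<-wellFounded)
open import Data.Nat.Solver using (module +-*-Solver)
open import Data.Fin using (Fin; zero; suc; toℕ; fromℕ<)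
open import Data.Fin.Properties using (_≟_; suc-injective; any?; toℕ-fromℕ<; toℕ-injective; toℕ<n)
open import Data.Bool using (Bool; true; false; not; _∨_; _xor_; if_then_else_)
open import Data.Bool.Properties using (∨-conicalˡ; ∨-conicalʳ) renaming (_≟_ to _≟ᵇ_)
open import Data.List using (List; []; _∷_; map; allFin; tabulate)
open import Data.List.Properties using (map-tabulate)
open import Data.List.Relation.Unary.All using (All; []; _∷_)
open import Data.Product using (Σ; ∃; ∃₂; _×_; _,_; proj₁; proj₂)
open import Data.Sum using (_⊎_; inj₁; inj₂)
open import Data.Empty using (⊥-elim)
open import Function using (_∘_; id)
open import Function.Bundles using (mk⇔)
open import Function.Definitions using (Injective)
open import Induction.WellFounded using (Acc; acc)
open import Relation.Nullary using (¬_; Dec; yes; no; does; ¬?)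
open import Relation.Nullary.Decidable using (dec-true; dec-false; does-⇔; _×-dec_; _⊎-dec_)
open import Relation.Binary.PropositionalEquality
open import Algebra.Properties.Semiring.Sum +-*-semiring
  using (sum; sum-cong-≗; ∑-distrib-+; ∑-comm; *-distribˡ-sum; *-distribʳ-sum)

-- Sums over Fin n and counting

true≢false : ¬ true ≡ false
true≢false ()

contraposeᵇ : ∀ {a b} → (a ≡ true → b ≡ true) → b ≡ false → a ≡ false
contraposeᵇ {false} _   _  = refl
contraposeᵇ {true}  a⇒b ¬b = ⊥-elim (true≢false (trans (sym (a⇒b refl)) ¬b))

𝟙 : Bool → ℕ
𝟙 b = if b then 1 else 0

𝟙≡0⇒false : ∀ {b} → 𝟙 b ≡ 0 → b ≡ false
𝟙≡0⇒false {false} _ = refl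

𝟙>0⇒true : ∀ {b} → 0 < 𝟙 b → b ≡ true
𝟙>0⇒true {true} _ = refl

𝟙-does-mono : ∀ {A B : Set} (a? : Dec A) (b? : Dec B) → (A → B) → 𝟙 (does a?) ≤ 𝟙 (does b?)
𝟙-does-mono (yes a) (yes _) _   = ≤-refl
𝟙-does-mono (yes a) (no ¬b) a→b = ⊥-elim (¬b (a→b a))
𝟙-does-mono (no _)  _       _   = z≤n

∑-mono-≤ : ∀ {n} {f g : Fin n → ℕ} → (∀ i → f i ≤ g i) → sum f ≤ sum g
∑-mono-≤ {zero}  f≤g = z≤n
∑-mono-≤ {suc n} f≤g = +-mono-≤ (f≤g zero) (∑-mono-≤ (f≤g ∘ suc))

∑-mono-< : ∀ {n} {f g : Fin n → ℕ} → (∀ i → f i ≤ g i) → ∀ j → f j < g j → sum f < sum g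
∑-mono-< f≤g zero    f<g = +-mono-<-≤ f<g (∑-mono-≤ (f≤g ∘ suc))
∑-mono-< f≤g (suc j) f<g = +-mono-≤-< (f≤g zero) (∑-mono-< (f≤g ∘ suc) j f<g)

∑≡0⇒≡0 : ∀ {n} (f : Fin n → ℕ) → sum f ≡ 0 → ∀ i → f i ≡ 0
∑≡0⇒≡0 f ∑≡0 zero    = m+n≡0⇒m≡0 (f zero) ∑≡0
∑≡0⇒≡0 f ∑≡0 (suc i) = ∑≡0⇒≡0 (f ∘ suc) (m+n≡0⇒n≡0 (f zero) ∑≡0) i

∑>0⇒∃>0 : ∀ {n} (f : Fin n → ℕ) → 0 < sum f → ∃ λ i → 0 < f i
∑>0⇒∃>0 {suc n} f ∑>0 with f zero in eq
... | suc _ = zero , subst (0 <_) (sym eq) (s≤s z≤n)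
... | zero  with ∑>0⇒∃>0 (f ∘ suc) ∑>0
...   | i , fi>0 = suc i , fi>0

∑<n⇒∃≡0 : ∀ {n} (f : Fin n → ℕ) → sum f < n → ∃ λ i → f i ≡ 0
∑<n⇒∃≡0 {suc n} f ∑<n with f zero in eq
... | zero  = zero , eq
... | suc _ with ∑<n⇒∃≡0 (f ∘ suc) (≤-trans (s≤s (m≤n+m _ _)) (≤-pred ∑<n))
...   | i , fi≡0 = suc i , fi≡0

∑-term : ∀ {n} (f : Fin n → ℕ) i → f i ≤ sum f
∑-term f zero    = m≤m+n (f zero) _
∑-term f (suc i) = ≤-trans (∑-term (f ∘ suc) i) (m≤n+m _ (f zero))

sum-allFin : ∀ {n} (f : Fin n → ℕ) → List.sum (map f (allFin n)) ≡ sum f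
sum-allFin f = trans (cong List.sum (map-tabulate id f)) (sum-tabulate f)
  where
  sum-tabulate : ∀ {n} (f : Fin n → ℕ) → List.sum (tabulate f) ≡ sum f
  sum-tabulate {zero}  f = refl
  sum-tabulate {suc n} f = cong (f zero +_) (sum-tabulate (f ∘ suc))

count : ∀ {n} → (Fin n → Bool) → ℕ
count p = sum (𝟙 ∘ p)

count-cong : ∀ {n} {f g : Fin n → Bool} → (∀ w → f w ≡ g w) → count f ≡ count g
count-cong f≗g = sum-cong-≗ (cong 𝟙 ∘ f≗g)

count-false : ∀ {n} → count {n} (λ _ → false) ≡ 0
count-false {zero}  = refl
count-false {suc n} = count-false {n}

count-true : ∀ {n} → count {n} (λ _ → true) ≡ n
count-true {zero}  = refl
count-true {suc n} = cong suc (count-true {n})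

count-mono : ∀ {n} (f g : Fin n → Bool) → (∀ {w} → f w ≡ true → g w ≡ true) → count f ≤ count g
count-mono f g f⊆g = ∑-mono-≤ pointwise
  where
  pointwise : ∀ w → 𝟙 (f w) ≤ 𝟙 (g w)
  pointwise w with f w in fw
  ... | false = z≤n
  ... | true  rewrite f⊆g fw = ≤-refl

count-update : ∀ {n} (f g : Fin n → Bool) p → (∀ w → ¬ w ≡ p → g w ≡ f w) →
               count g + 𝟙 (f p) ≡ count f + 𝟙 (g p)
count-update f g zero g≡f = begin
  𝟙 (g zero) + count (g ∘ suc) + 𝟙 (f zero) ≡⟨ cong (λ c → 𝟙 (g zero) + c + 𝟙 (f zero)) (count-cong (λ w → g≡f (suc w) λ ())) ⟩
  𝟙 (g zero) + count (f ∘ suc) + 𝟙 (f zero) ≡⟨ solve 3 (λ a b c → a :+ b :+ c := c :+ b :+ a) refl (𝟙 (g zero)) (count (f ∘ suc)) (𝟙 (f zero)) ⟩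
  𝟙 (f zero) + count (f ∘ suc) + 𝟙 (g zero) ∎
  where
  open ≡-Reasoning
  open +-*-Solver
count-update f g (suc p) g≡f = begin
  𝟙 (g zero) + count (g ∘ suc) + 𝟙 (f (suc p)) ≡⟨ +-assoc (𝟙 (g zero)) _ _ ⟩
  𝟙 (g zero) + (count (g ∘ suc) + 𝟙 (f (suc p))) ≡⟨ cong₂ _+_ (cong 𝟙 (g≡f zero λ ())) rest ⟩
  𝟙 (f zero) + (count (f ∘ suc) + 𝟙 (g (suc p))) ≡⟨ +-assoc (𝟙 (f zero)) _ _ ⟨
  𝟙 (f zero) + count (f ∘ suc) + 𝟙 (g (suc p)) ∎
  where
  open ≡-Reasoning
  rest : count (g ∘ suc) + 𝟙 (f (suc p)) ≡ count (f ∘ suc) + 𝟙 (g (suc p))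
  rest = count-update (f ∘ suc) (g ∘ suc) p (λ w w≢p → g≡f (suc w) (w≢p ∘ suc-injective))

⁅_⁆ : ∀ {n} → Fin n → Fin n → Bool
⁅ p ⁆ w = does (w ≟ p)

⁅⁆-self : ∀ {n} (p : Fin n) → ⁅ p ⁆ p ≡ true
⁅⁆-self p = dec-true (p ≟ p) refl

⁅⁆-other : ∀ {n} {p w : Fin n} → ¬ w ≡ p → ⁅ p ⁆ w ≡ false
⁅⁆-other {p = p} {w} w≢p = dec-false (w ≟ p) w≢p

⁅⁆-false : ∀ {n} {p w : Fin n} → ⁅ p ⁆ w ≡ false → ¬ w ≡ p
⁅⁆-false {p = p} {w} w∉ w≡p = true≢false (trans (sym (dec-true (w ≟ p) w≡p)) w∉)

count-⁅⁆ : ∀ {n} (p : Fin n) → count ⁅ p ⁆ ≡ 1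
count-⁅⁆ {suc n} zero    = cong suc (count-false {n})
count-⁅⁆ {suc n} (suc p) = count-⁅⁆ p

insert : ∀ {n} → Fin n → (Fin n → Bool) → Fin n → Bool
insert p f w = ⁅ p ⁆ w ∨ f w

count-insert : ∀ {n} (p : Fin n) (f : Fin n → Bool) → f p ≡ false → count (insert p f) ≡ suc (count f)
count-insert p f fp = begin
  count (insert p f)                ≡⟨ +-identityʳ _ ⟨
  count (insert p f) + 𝟙 false      ≡⟨ cong (λ b → count (insert p f) + 𝟙 b) fp ⟨
  count (insert p f) + 𝟙 (f p)      ≡⟨ count-update f (insert p f) p (λ w w≢p → cong (_∨ f w) (⁅⁆-other w≢p)) ⟩
  count f + 𝟙 (insert p f p)        ≡⟨ cong (λ b → count f + 𝟙 (b ∨ f p)) (⁅⁆-self p) ⟩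
  count f + 1                       ≡⟨ +-comm _ 1 ⟩
  suc (count f)                     ∎
  where open ≡-Reasoning

⋃ : ∀ {n} → List (Fin n → Bool) → Fin n → Bool
⋃ []       w = false
⋃ (f ∷ fs) w = f w ∨ ⋃ fs w

count-⋃ : ∀ {n} (fs : List (Fin n → Bool)) → count (⋃ fs) ≤ List.sum (map count fs)
count-⋃ {n} []       = ≤-reflexive (count-false {n})
count-⋃     (f ∷ fs) = begin
  count (⋃ (f ∷ fs))                   ≤⟨ ∑-mono-≤ (λ w → 𝟙-∨ (f w) (⋃ fs w)) ⟩
  sum (λ w → 𝟙 (f w) + 𝟙 (⋃ fs w))    ≡⟨ ∑-distrib-+ (𝟙 ∘ f) (𝟙 ∘ ⋃ fs) ⟩
  count f + count (⋃ fs)               ≤⟨ +-monoʳ-≤ (count f) (count-⋃ fs) ⟩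
  count f + List.sum (map count fs)    ∎
  where
  open ≤-Reasoning
  𝟙-∨ : ∀ a b → 𝟙 (a ∨ b) ≤ 𝟙 a + 𝟙 b
  𝟙-∨ true  b = s≤s z≤n
  𝟙-∨ false b = ≤-refl

⋃-false : ∀ {n} (fs : List (Fin n → Bool)) w → ⋃ fs w ≡ false → All (λ f → f w ≡ false) fs
⋃-false []       w _       = []
⋃-false (f ∷ fs) w fs-miss = ∨-conicalˡ (f w) _ fs-miss ∷ ⋃-false fs w (∨-conicalʳ (f w) _ fs-miss)

image : ∀ {m n} → (Fin m → Fin n) → Fin n → Bool
image σ w = does (any? λ j → w ≟ σ j)

image-member : ∀ {m n} (σ : Fin m → Fin n) {w} → image σ w ≡ true → ∃ λ j → w ≡ σ j
image-member σ {w} with any? (λ j → w ≟ σ j)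
... | yes found = λ _ → found

count-image : ∀ {m n} (σ : Fin m → Fin n) → Injective _≡_ _≡_ σ → count (image σ) ≡ m
count-image {m} σ σ-inj = begin
  count (image σ)                          ≡⟨ sum-cong-≗ multiplicity ⟩
  sum (λ w → count (λ j → does (w ≟ σ j))) ≡⟨ ∑-comm (λ w j → 𝟙 (does (w ≟ σ j))) ⟩
  sum (λ j → count (λ w → does (w ≟ σ j))) ≡⟨ sum-cong-≗ (count-⁅⁆ ∘ σ) ⟩
  count {m} (λ _ → true)                   ≡⟨ count-true ⟩
  m                                        ∎
  where
  open ≡-Reasoning
  multiplicity : ∀ w → 𝟙 (image σ w) ≡ count (λ j → does (w ≟ σ j))
  multiplicity w with any? (λ j → w ≟ σ j)
  ... | yes (j₀ , refl) = sym (trans (sum-cong-≗ (cong 𝟙 ∘ same-test)) (count-⁅⁆ j₀))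
    where
    same-test : ∀ j → does (σ j₀ ≟ σ j) ≡ does (j ≟ j₀)
    same-test j = does-⇔ (mk⇔ (sym ∘ σ-inj) (cong σ ∘ sym)) (σ j₀ ≟ σ j) (j ≟ j₀)
  ... | no ∄j = sym (trans (sum-cong-≗ λ j → cong 𝟙 (dec-false (w ≟ σ j) λ e → ∄j (j , e))) (count-false {m}))

count₂ : ∀ {n} {R : Fin n → Fin n → Set} → (∀ u w → Dec (R u w)) → ℕ
count₂ R? = sum λ u → count λ w → does (R? u w)

count₂-< : ∀ {n} {R R′ : Fin n → Fin n → Set} (R? : ∀ u w → Dec (R u w)) (R′? : ∀ u w → Dec (R′ u w)) →
           (∀ {u w} → R u w → R′ u w) → ∀ {u w} → R′ u w → ¬ R u w → count₂ R? < count₂ R′?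
count₂-< R? R′? R⇒R′ {u} {w} R′uw ¬Ruw =
  ∑-mono-< (λ u′ → ∑-mono-≤ (λ w′ → mono u′ w′)) u (∑-mono-< (mono u) w strict)
  where
  mono : ∀ u′ w′ → 𝟙 (does (R? u′ w′)) ≤ 𝟙 (does (R′? u′ w′))
  mono u′ w′ = 𝟙-does-mono (R? u′ w′) (R′? u′ w′) R⇒R′
  strict : 𝟙 (does (R? u w)) < 𝟙 (does (R′? u w))
  strict rewrite dec-false (R? u w) ¬Ruw | dec-true (R′? u w) R′uw = s≤s z≤n

count₂-pos : ∀ {n} {R : Fin n → Fin n → Set} (R? : ∀ u w → Dec (R u w)) → 0 < count₂ R? → ∃₂ R
count₂-pos R? pos with ∑>0⇒∃>0 _ pos
... | u , row>0 with ∑>0⇒∃>0 _ row>0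
...   | w , entry>0 with R? u w
...     | yes Ruw = u , w , Ruw

count₂-zero : ∀ {n} {R : Fin n → Fin n → Set} (R? : ∀ u w → Dec (R u w)) → count₂ R? ≡ 0 → ∀ {u w} → ¬ R u w
count₂-zero R? none {u} {w} Ruw =
  true≢false (trans (sym (dec-true (R? u w) Ruw)) (𝟙≡0⇒false (∑≡0⇒≡0 _ (∑≡0⇒≡0 _ none u) w)))

-- Non-increasing sequences

NonIncreasingℕ : (ℕ → ℕ) → Set
NonIncreasingℕ g = ∀ {i j} → i ≤ j → g j ≤ g i

repeat-or-descend : ∀ (h : ℕ → ℕ) → NonIncreasingℕ h → ∀ m →
                    (∃ λ j → j < m × h (suc j) ≡ h j) ⊎ m + h m ≤ h 0
repeat-or-descend h h↓ zero = inj₂ ≤-refl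
repeat-or-descend h h↓ (suc m) with repeat-or-descend h h↓ m
... | inj₁ (j , j<m , repeat) = inj₁ (j , m<n⇒m<1+n j<m , repeat)
... | inj₂ descent with h (suc m) ℕ.≟ h m
...   | yes repeat = inj₁ (m , ≤-refl , repeat)
...   | no ¬repeat = inj₂ (begin
  suc m + h (suc m) ≡⟨ +-suc m _ ⟨
  m + suc (h (suc m)) ≤⟨ +-monoʳ-≤ m (≤∧≢⇒< (h↓ (n≤1+n m)) ¬repeat) ⟩
  m + h m             ≤⟨ descent ⟩
  h 0                 ∎)
  where open ≤-Reasoning

plateau : ∀ (g : ℕ → ℕ) → NonIncreasingℕ g → ∀ {i m} → g (i + m) ≡ g i → ∀ {t} → t ≤ m → g (i + t) ≡ g i
plateau g g↓ {i} end≡start t≤m =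
  ≤-antisym (g↓ (m≤m+n i _)) (subst (_≤ g (i + _)) end≡start (g↓ (+-monoʳ-≤ i t≤m)))

long-plateau : ∀ (g : ℕ → ℕ) → NonIncreasingℕ g → ∀ Δ → g 0 ≤ Δ → 0 < g (Δ * Δ) →
               ∃ λ i → i + Δ ≤ Δ * Δ × (∀ {t} → t ≤ Δ → g (i + t) ≡ g i)
long-plateau g g↓ Δ g0≤Δ g>0 with repeat-or-descend (λ j → g (j * Δ)) (λ j≤j′ → g↓ (*-monoˡ-≤ Δ j≤j′)) Δ
... | inj₁ (j , j<Δ , repeat) =
  j * Δ , subst (_≤ Δ * Δ) (+-comm Δ (j * Δ)) (*-monoˡ-≤ Δ j<Δ) ,
  plateau g g↓ (trans (cong g (+-comm (j * Δ) Δ)) repeat)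
... | inj₂ descent = ⊥-elim (<⇒≱ (+-monoʳ-< Δ g>0) (begin
  Δ + g (Δ * Δ) ≤⟨ descent ⟩
  g 0           ≤⟨ g0≤Δ ⟩
  Δ             ≡⟨ +-identityʳ Δ ⟨
  Δ + 0         ∎))
  where open ≤-Reasoning

-- Graphs, edge toggles and 2-switches

degree-count : ∀ {n} (G : SimpleGraph n) v → degree G v ≡ count (Adj G v)
degree-count G v = sum-allFin (𝟙 ∘ Adj G v)

adjacent⇒degree>0 : ∀ {n} (G : SimpleGraph n) {v w} → Adj G v w ≡ true → 0 < degree G v
adjacent⇒degree>0 G {v} {w} vw =
  subst (0 <_) (sym (degree-count G v)) (≤-trans (subst (λ b → 0 < 𝟙 b) (sym vw) (s≤s z≤n)) (∑-term (𝟙 ∘ Adj G v) w))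

neighbour : ∀ {n} (G : SimpleGraph n) v → 0 < degree G v → ∃ λ w → Adj G v w ≡ true
neighbour G v deg>0 with ∑>0⇒∃>0 (𝟙 ∘ Adj G v) (subst (0 <_) (degree-count G v) deg>0)
... | w , vw = w , 𝟙>0⇒true vw

reach-neighbour : ∀ {n} {G : SimpleGraph n} {u v} → Reach G u v → ¬ u ≡ v → ∃ λ w → Adj G w v ≡ true
reach-neighbour here          u≢u = ⊥-elim (u≢u refl)
reach-neighbour (step {v = w} _ wv) _ = w , wv

Pair : ∀ {n} → Fin n → Fin n → Fin n → Fin n → Set
Pair x y u w = (u ≡ x × w ≡ y) ⊎ (u ≡ y × w ≡ x)

pair? : ∀ {n} (x y u w : Fin n) → Dec (Pair x y u w)
pair? x y u w = ((u ≟ x) ×-dec (w ≟ y)) ⊎-dec ((u ≟ y) ×-dec (w ≟ x))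

Pair-swap : ∀ {n} {x y u w : Fin n} → Pair x y u w → Pair x y w u
Pair-swap (inj₁ (u≡x , w≡y)) = inj₂ (w≡y , u≡x)
Pair-swap (inj₂ (u≡y , w≡x)) = inj₁ (w≡x , u≡y)

Adj-Pair : ∀ {n} (G : SimpleGraph n) {x y u w} → Pair x y u w → Adj G u w ≡ Adj G x y
Adj-Pair G (inj₁ (refl , refl)) = refl
Adj-Pair G (inj₂ (refl , refl)) = SimpleGraph.sym G _ _

avoids : ∀ {n} {x y u w : Fin n} → ¬ u ≡ x → ¬ u ≡ y → ¬ Pair x y u w
avoids u≢x u≢y (inj₁ (u≡x , _)) = u≢x u≡x
avoids u≢x u≢y (inj₂ (u≡y , _)) = u≢y u≡y

avoids′ : ∀ {n} {x y u w : Fin n} → ¬ w ≡ x → ¬ w ≡ y → ¬ Pair x y u w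
avoids′ w≢x w≢y (inj₁ (_ , w≡y)) = w≢y w≡y
avoids′ w≢x w≢y (inj₂ (_ , w≡x)) = w≢x w≡x

Pair-partner : ∀ {n} {x y v p w : Fin n} → ¬ x ≡ y → Pair x y v p → Pair x y v w → w ≡ p
Pair-partner x≢y (inj₁ (refl , refl)) (inj₁ (_ , refl))    = refl
Pair-partner x≢y (inj₁ (refl , refl)) (inj₂ (refl , _))    = ⊥-elim (x≢y refl)
Pair-partner x≢y (inj₂ (refl , refl)) (inj₁ (refl , _))    = ⊥-elim (x≢y refl)
Pair-partner x≢y (inj₂ (refl , refl)) (inj₂ (_ , refl))    = refl

module _ {n} (G : SimpleGraph n) (x y : Fin n) (x≢y : ¬ x ≡ y) where

  toggle : SimpleGraph n
  toggle = record
    { Adj    = λ u w → does (pair? x y u w) xor Adj G u w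
    ; sym    = λ u w → cong₂ _xor_ (does-⇔ (mk⇔ Pair-swap Pair-swap) (pair? x y u w) (pair? x y w u))
                                     (SimpleGraph.sym G u w)
    ; irrefl = λ v → cong₂ _xor_ (dec-false (pair? x y v v) (x≢y ∘ diagonal)) (SimpleGraph.irrefl G v)
    }
    where
    diagonal : ∀ {v} → Pair x y v v → x ≡ y
    diagonal (inj₁ (refl , refl)) = refl
    diagonal (inj₂ (refl , refl)) = refl

  Adj-toggle : ∀ {u w} → ¬ Pair x y u w → Adj toggle u w ≡ Adj G u w
  Adj-toggle {u} {w} ¬pair = cong (_xor Adj G u w) (dec-false (pair? x y u w) ¬pair)

  Adj-toggle-pair : ∀ {u w} → Pair x y u w → Adj toggle u w ≡ not (Adj G u w)
  Adj-toggle-pair {u} {w} pair = cong (_xor Adj G u w) (dec-true (pair? x y u w) pair)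

  degree-toggle : ∀ {v} → ¬ v ≡ x → ¬ v ≡ y → degree toggle v ≡ degree G v
  degree-toggle {v} v≢x v≢y = begin
    degree toggle v      ≡⟨ degree-count toggle v ⟩
    count (Adj toggle v) ≡⟨ count-cong (λ w → Adj-toggle {v} {w} (avoids v≢x v≢y)) ⟩
    count (Adj G v)      ≡⟨ degree-count G v ⟨
    degree G v           ∎
    where open ≡-Reasoning

  degree-toggle-end : ∀ {v p} → Pair x y v p →
                      degree toggle v + 𝟙 (Adj G x y) ≡ degree G v + 𝟙 (not (Adj G x y))
  degree-toggle-end {v} {p} pair = begin
    degree toggle v + 𝟙 (Adj G x y)     ≡⟨ cong₂ _+_ (degree-count toggle v) (cong 𝟙 (sym (Adj-Pair G pair))) ⟩
    count (Adj toggle v) + 𝟙 (Adj G v p)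
      ≡⟨ count-update (Adj G v) (Adj toggle v) p (λ w w≢p → Adj-toggle (w≢p ∘ Pair-partner x≢y pair)) ⟩
    count (Adj G v) + 𝟙 (Adj toggle v p) ≡⟨ cong₂ _+_ (degree-count G v) (cong 𝟙 (sym (Adj-toggle-pair pair))) ⟨
    degree G v + 𝟙 (not (Adj G v p))   ≡⟨ cong (λ b → degree G v + 𝟙 (not b)) (Adj-Pair G pair) ⟩
    degree G v + 𝟙 (not (Adj G x y))   ∎
    where open ≡-Reasoning

  degree-toggle-remove : Adj G x y ≡ true → ∀ {v p} → Pair x y v p → suc (degree toggle v) ≡ degree G v
  degree-toggle-remove xy {v} pair = begin
    suc (degree toggle v)            ≡⟨ +-comm 1 _ ⟩
    degree toggle v + 𝟙 true         ≡⟨ subst (λ b → degree toggle v + 𝟙 b ≡ degree G v + 𝟙 (not b)) xy (degree-toggle-end pair) ⟩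
    degree G v + 0                   ≡⟨ +-identityʳ _ ⟩
    degree G v                       ∎
    where open ≡-Reasoning

  degree-toggle-add : Adj G x y ≡ false → ∀ {v p} → Pair x y v p → degree toggle v ≡ suc (degree G v)
  degree-toggle-add xy {v} pair = begin
    degree toggle v                  ≡⟨ +-identityʳ _ ⟨
    degree toggle v + 𝟙 false        ≡⟨ subst (λ b → degree toggle v + 𝟙 b ≡ degree G v + 𝟙 (not b)) xy (degree-toggle-end pair) ⟩
    degree G v + 1                   ≡⟨ +-comm _ 1 ⟩
    suc (degree G v)                 ∎
    where open ≡-Reasoning

  toggle-keeps-edge : Adj G x y ≡ false → ∀ {u w} → Adj G u w ≡ true → Adj toggle u w ≡ true
  toggle-keeps-edge xy {u} {w} uw with pair? x y u w
  ... | yes pair = ⊥-elim (true≢false (trans (sym uw) (trans (Adj-Pair G pair) xy)))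
  ... | no ¬pair = trans (Adj-toggle ¬pair) uw

module Switch {n} (G : SimpleGraph n) {a b c e : Fin n}
  (a≢b : ¬ a ≡ b) (a≢c : ¬ a ≡ c) (a≢e : ¬ a ≡ e) (b≢c : ¬ b ≡ c) (b≢e : ¬ b ≡ e) (c≢e : ¬ c ≡ e)
  (ab : Adj G a b ≡ true) (ce : Adj G c e ≡ true) (ac : Adj G a c ≡ false) (be : Adj G b e ≡ false)
  where

  private
    G₁ G₂ G₃ : SimpleGraph n
    G₁ = toggle G a b a≢b
    G₂ = toggle G₁ c e c≢e
    G₃ = toggle G₂ a c a≢c

    ce₁ : Adj G₁ c e ≡ true
    ce₁ = trans (Adj-toggle G a b a≢b (avoids (≢-sym a≢c) (≢-sym b≢c))) ce

    ac₂ : Adj G₂ a c ≡ false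
    ac₂ = begin
      Adj G₂ a c ≡⟨ Adj-toggle G₁ c e c≢e (avoids a≢c a≢e) ⟩
      Adj G₁ a c ≡⟨ Adj-toggle G a b a≢b (avoids′ (≢-sym a≢c) (≢-sym b≢c)) ⟩
      Adj G a c  ≡⟨ ac ⟩
      false      ∎
      where open ≡-Reasoning

    be₃ : Adj G₃ b e ≡ false
    be₃ = begin
      Adj G₃ b e ≡⟨ Adj-toggle G₂ a c a≢c (avoids (≢-sym a≢b) b≢c) ⟩
      Adj G₂ b e ≡⟨ Adj-toggle G₁ c e c≢e (avoids b≢c b≢e) ⟩
      Adj G₁ b e ≡⟨ Adj-toggle G a b a≢b (avoids′ (≢-sym a≢e) (≢-sym b≢e)) ⟩
      Adj G b e  ≡⟨ be ⟩
      false      ∎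
      where open ≡-Reasoning

  switch : SimpleGraph n
  switch = toggle G₃ b e b≢e

  Adj-switch-ac : Adj switch a c ≡ true
  Adj-switch-ac = trans (Adj-toggle G₃ b e b≢e (avoids a≢b a≢e))
                        (trans (Adj-toggle-pair G₂ a c a≢c (inj₁ (refl , refl))) (cong not ac₂))

  Adj-switch-be : Adj switch b e ≡ true
  Adj-switch-be = trans (Adj-toggle-pair G₃ b e b≢e (inj₁ (refl , refl))) (cong not be₃)

  degree-switch : ∀ v → degree switch v ≡ degree G v
  degree-switch v = by-cases (v ≟ a) (v ≟ b) (v ≟ c) (v ≟ e)
    where
    by-cases : Dec (v ≡ a) → Dec (v ≡ b) → Dec (v ≡ c) → Dec (v ≡ e) → degree switch v ≡ degree G v
    by-cases (yes refl) _ _ _ = begin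
      degree switch a   ≡⟨ degree-toggle G₃ b e b≢e a≢b a≢e ⟩
      degree G₃ a       ≡⟨ degree-toggle-add G₂ a c a≢c ac₂ (inj₁ (refl , refl)) ⟩
      suc (degree G₂ a) ≡⟨ cong suc (degree-toggle G₁ c e c≢e a≢c a≢e) ⟩
      suc (degree G₁ a) ≡⟨ degree-toggle-remove G a b a≢b ab (inj₁ (refl , refl)) ⟩
      degree G a        ∎
      where open ≡-Reasoning
    by-cases (no _) (yes refl) _ _ = begin
      degree switch b   ≡⟨ degree-toggle-add G₃ b e b≢e be₃ (inj₁ (refl , refl)) ⟩
      suc (degree G₃ b) ≡⟨ cong suc (degree-toggle G₂ a c a≢c (≢-sym a≢b) b≢c) ⟩
      suc (degree G₂ b) ≡⟨ cong suc (degree-toggle G₁ c e c≢e b≢c b≢e) ⟩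
      suc (degree G₁ b) ≡⟨ degree-toggle-remove G a b a≢b ab (inj₂ (refl , refl)) ⟩
      degree G b        ∎
      where open ≡-Reasoning
    by-cases (no _) (no _) (yes refl) _ = begin
      degree switch c   ≡⟨ degree-toggle G₃ b e b≢e (≢-sym b≢c) c≢e ⟩
      degree G₃ c       ≡⟨ degree-toggle-add G₂ a c a≢c ac₂ (inj₂ (refl , refl)) ⟩
      suc (degree G₂ c) ≡⟨ degree-toggle-remove G₁ c e c≢e ce₁ (inj₁ (refl , refl)) ⟩
      degree G₁ c       ≡⟨ degree-toggle G a b a≢b (≢-sym a≢c) (≢-sym b≢c) ⟩
      degree G c        ∎
      where open ≡-Reasoning
    by-cases (no _) (no _) (no _) (yes refl) = begin
      degree switch e   ≡⟨ degree-toggle-add G₃ b e b≢e be₃ (inj₂ (refl , refl)) ⟩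
      suc (degree G₃ e) ≡⟨ cong suc (degree-toggle G₂ a c a≢c (≢-sym a≢e) (≢-sym c≢e)) ⟩
      suc (degree G₂ e) ≡⟨ degree-toggle-remove G₁ c e c≢e ce₁ (inj₂ (refl , refl)) ⟩
      degree G₁ e       ≡⟨ degree-toggle G a b a≢b (≢-sym a≢e) (≢-sym b≢e) ⟩
      degree G e        ∎
      where open ≡-Reasoning
    by-cases (no v≢a) (no v≢b) (no v≢c) (no v≢e) = begin
      degree switch v ≡⟨ degree-toggle G₃ b e b≢e v≢b v≢e ⟩
      degree G₃ v     ≡⟨ degree-toggle G₂ a c a≢c v≢a v≢c ⟩
      degree G₂ v     ≡⟨ degree-toggle G₁ c e c≢e v≢c v≢e ⟩
      degree G₁ v     ≡⟨ degree-toggle G a b a≢b v≢a v≢b ⟩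
      degree G v      ∎
      where open ≡-Reasoning

  Adj-switch : ∀ {u w} → ¬ Pair a b u w → ¬ Pair c e u w → ¬ Pair a c u w → ¬ Pair b e u w →
               Adj switch u w ≡ Adj G u w
  Adj-switch ¬ab ¬ce ¬ac ¬be =
    trans (Adj-toggle G₃ b e b≢e ¬be) (trans (Adj-toggle G₂ a c a≢c ¬ac)
      (trans (Adj-toggle G₁ c e c≢e ¬ce) (Adj-toggle G a b a≢b ¬ab)))

  switch-keeps-edge : ∀ {u w} → Adj G u w ≡ true → ¬ Pair a b u w → ¬ Pair c e u w → Adj switch u w ≡ true
  switch-keeps-edge {u} {w} uw ¬ab ¬ce =
    toggle-keeps-edge G₃ b e b≢e be₃ {u} {w} (toggle-keeps-edge G₂ a c a≢c ac₂ {u} {w}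
      (trans (Adj-toggle G₁ c e c≢e ¬ce) (trans (Adj-toggle G a b a≢b ¬ab) uw)))

far-vertex : ∀ {n} (G : SimpleGraph n) (bad : Fin n → Bool) {Δ} → (∀ v → degree G v ≤ Δ) →
             suc Δ * count bad < n → ∃ λ y → bad y ≡ false × (∀ z → Adj G z y ≡ true → bad z ≡ false)
far-vertex {n} G bad {Δ} deg≤Δ small = far (∑<n⇒∃≡0 weight (≤-<-trans total small))
  where
  -- Summed over y, the weight counts each bad z at most 1 + degree z times.
  weight : Fin n → ℕ
  weight y = 𝟙 (bad y) + sum (λ z → 𝟙 (bad z) * 𝟙 (Adj G z y))

  total : sum weight ≤ suc Δ * count bad
  total = begin
    sum weight                                                     ≡⟨ ∑-distrib-+ (𝟙 ∘ bad) _ ⟩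
    count bad + sum (λ y → sum (λ z → 𝟙 (bad z) * 𝟙 (Adj G z y))) ≡⟨ cong (count bad +_) (∑-comm {n} {n} _) ⟩
    count bad + sum (λ z → sum (λ y → 𝟙 (bad z) * 𝟙 (Adj G z y)))
      ≡⟨ cong (count bad +_) (sum-cong-≗ {n} λ z → *-distribˡ-sum (𝟙 (bad z)) (𝟙 ∘ Adj G z)) ⟨
    count bad + sum (λ z → 𝟙 (bad z) * count (Adj G z))
      ≤⟨ +-monoʳ-≤ (count bad) (∑-mono-≤ λ z → *-monoʳ-≤ (𝟙 (bad z)) (subst (_≤ Δ) (degree-count G z) (deg≤Δ z))) ⟩
    count bad + sum (λ z → 𝟙 (bad z) * Δ)                          ≡⟨ cong (count bad +_) (*-distribʳ-sum Δ (𝟙 ∘ bad)) ⟨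
    count bad + count bad * Δ                                      ≡⟨ cong (count bad +_) (*-comm (count bad) Δ) ⟩
    suc Δ * count bad                                              ∎
    where open ≤-Reasoning

  far : (∃ λ y → weight y ≡ 0) → ∃ λ y → bad y ≡ false × (∀ z → Adj G z y ≡ true → bad z ≡ false)
  far (y , weight≡0) = y , 𝟙≡0⇒false (m+n≡0⇒m≡0 _ weight≡0) , neighbour-good
    where
    neighbour-good : ∀ z → Adj G z y ≡ true → bad z ≡ false
    neighbour-good z zy = 𝟙≡0⇒false (trans (sym (*-identityʳ _))
      (subst (λ b → 𝟙 (bad z) * 𝟙 b ≡ 0) zy (∑≡0⇒≡0 _ (m+n≡0⇒n≡0 (𝟙 (bad y)) weight≡0) z)))

far-edge : ∀ {n} (G : SimpleGraph n) (bad : Fin n → Bool) {Δ} → (∀ v → degree G v ≤ Δ) → (∀ v → 0 < degree G v) →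
           suc Δ * count bad < n → ∃₂ λ x y → Adj G y x ≡ true × bad y ≡ false × bad x ≡ false
far-edge G bad deg≤Δ deg>0 small =
  let y , y-far , neighbours-far = far-vertex G bad deg≤Δ small
      x , yx = neighbour G y (deg>0 y)
  in x , y , yx , y-far , neighbours-far x (trans (SimpleGraph.sym G x y) yx)

-- A set of k + 1 vertices of degree k

module CliqueComponent {n} (d : Fin n → ℕ) {Δ k : ℕ} (d≤Δ : ∀ v → d v ≤ Δ) (d>0 : ∀ v → 0 < d v)
  (S : Fin n → Bool) (|S| : count S ≡ suc k) (d-S : ∀ {s} → S s ≡ true → d s ≡ k)
  (large : suc Δ * (4 * suc Δ) < n) where

  inside≢outside : ∀ {u w} → S u ≡ true → S w ≡ false → ¬ u ≡ w
  inside≢outside u∈S w∉S refl = true≢false (trans (sym u∈S) w∉S)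

  Clique : SimpleGraph n → Set
  Clique G = ∀ {u w} → S u ≡ true → S w ≡ true → ¬ u ≡ w → Adj G u w ≡ true

  degree-inside : ∀ G → Realizes G d → ∀ {s} → S s ≡ true → count (Adj G s) ≡ k
  degree-inside G r {s} s∈S = trans (sym (degree-count G s)) (trans (r s) (d-S s∈S))

  escape : ∀ G → Realizes G d → ∀ {s s′} → S s ≡ true → S s′ ≡ true → ¬ s ≡ s′ → Adj G s s′ ≡ false →
           ∃ λ t → Adj G s t ≡ true × S t ≡ false
  escape G r {s} {s′} s∈S s′∈S s≢s′ ss′ with any? (λ t → (Adj G s t ≟ᵇ true) ×-dec (S t ≟ᵇ false))
  ... | yes found = found
  ... | no none = ⊥-elim (1+n≰n (begin
    -- otherwise N(s) ∪ {s, s′}, a set of k + 2 vertices, would lie inside S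
    suc (suc k)                                   ≡⟨ cong (2 +_) (degree-inside G r s∈S) ⟨
    suc (suc (count (Adj G s)))                   ≡⟨ cong suc (count-insert s (Adj G s) (SimpleGraph.irrefl G s)) ⟨
    suc (count (insert s (Adj G s)))              ≡⟨ count-insert s′ (insert s (Adj G s)) s′-new ⟨
    count (insert s′ (insert s (Adj G s)))        ≤⟨ count-mono (insert s′ (insert s (Adj G s))) S inside ⟩
    count S                                       ≡⟨ |S| ⟩
    suc k                                         ∎))
    where
    open ≤-Reasoning
    s′-new : insert s (Adj G s) s′ ≡ false
    s′-new rewrite ⁅⁆-other (s≢s′ ∘ sym) = ss′
    inside : ∀ {w} → insert s′ (insert s (Adj G s)) w ≡ true → S w ≡ true
    inside {w} w∈ with w ≟ s′ | w ≟ s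
    ... | yes refl | _        = s′∈S
    ... | no _     | yes refl = s∈S
    ... | no _     | no _     with S w in w∈S
    ...   | true  = refl
    ...   | false = ⊥-elim (none (w , w∈ , w∈S))

  clique-closed : ∀ G → Realizes G d → Clique G → ∀ {s w} → S s ≡ true → Adj G s w ≡ true → S w ≡ true
  clique-closed G r clique {s} {w} s∈S sw with S w in w∈S
  ... | true  = refl
  ... | false = ⊥-elim (1+n≰n (begin
    -- otherwise S ∪ {w}, a set of k + 2 vertices, would lie inside N(s) ∪ {s}
    suc (suc k)                    ≡⟨ cong suc |S| ⟨
    suc (count S)                  ≡⟨ count-insert w S w∈S ⟨
    count (insert w S)             ≤⟨ count-mono (insert w S) (insert s (Adj G s)) neighbours ⟩
    count (insert s (Adj G s))     ≡⟨ count-insert s (Adj G s) (SimpleGraph.irrefl G s) ⟩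
    suc (count (Adj G s))          ≡⟨ cong suc (degree-inside G r s∈S) ⟩
    suc k                          ∎))
    where
    open ≤-Reasoning
    neighbours : ∀ {v} → insert w S v ≡ true → insert s (Adj G s) v ≡ true
    neighbours {v} v∈ with v ≟ s | v ≟ w
    ... | yes refl | _        = refl
    ... | no _     | yes refl = sw
    ... | no v≢s   | no _     = clique s∈S v∈ (v≢s ∘ sym)

  inside-member : ∃ λ s → S s ≡ true
  inside-member with ∑>0⇒∃>0 (𝟙 ∘ S) (subst (0 <_) (sym |S|) (s≤s z≤n))
  ... | s , s∈S = s , 𝟙>0⇒true s∈S

  k≤Δ : k ≤ Δ
  k≤Δ = subst (_≤ Δ) (d-S (proj₂ inside-member)) (d≤Δ (proj₁ inside-member))

  outside-member : ∃ λ o → S o ≡ false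
  outside-member with ∑<n⇒∃≡0 (𝟙 ∘ S) (begin-strict
    count S             ≡⟨ |S| ⟩
    suc k               ≤⟨ s≤s k≤Δ ⟩
    suc Δ               ≤⟨ m≤m*n (suc Δ) (4 * suc Δ) ⟩
    suc Δ * (4 * suc Δ) <⟨ large ⟩
    n                   ∎)
    where open ≤-Reasoning
  ... | o , o∉S = o , 𝟙≡0⇒false o∉S

  clique-disconnected : ∀ G → Realizes G d → Clique G → ¬ Connected G
  clique-disconnected G r clique connected =
    inside≢outside (stays-inside (connected s o)) o∉S refl
    where
    s = proj₁ inside-member
    o = proj₁ outside-member
    o∉S = proj₂ outside-member
    stays-inside : ∀ {w} → Reach G s w → S w ≡ true
    stays-inside here           = proj₂ inside-member
    stays-inside (step walk vw) = clique-closed G r clique (stays-inside walk) vw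

  Missing : SimpleGraph n → Fin n → Fin n → Set
  Missing G u w = S u ≡ true × S w ≡ true × ¬ u ≡ w × Adj G u w ≡ false

  missing? : ∀ G u w → Dec (Missing G u w)
  missing? G u w = (S u ≟ᵇ true) ×-dec (S w ≟ᵇ true) ×-dec ¬? (u ≟ w) ×-dec (Adj G u w ≟ᵇ false)

  missing-pairs : SimpleGraph n → ℕ
  missing-pairs G = count₂ (missing? G)

  no-missing⇒clique : ∀ G → missing-pairs G ≡ 0 → Clique G
  no-missing⇒clique G none {u} {w} u∈S w∈S u≢w with Adj G u w in uw
  ... | true  = refl
  ... | false = ⊥-elim (count₂-zero (missing? G) none (u∈S , w∈S , u≢w , uw))

  outside-¬Pairˡ : ∀ {x y u w} → S x ≡ false → S u ≡ true → S w ≡ true → ¬ Pair x y u w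
  outside-¬Pairˡ x∉S u∈S w∈S (inj₁ (u≡x , _)) = inside≢outside u∈S x∉S u≡x
  outside-¬Pairˡ x∉S u∈S w∈S (inj₂ (_ , w≡x)) = inside≢outside w∈S x∉S w≡x

  outside-¬Pairʳ : ∀ {x y u w} → S y ≡ false → S u ≡ true → S w ≡ true → ¬ Pair x y u w
  outside-¬Pairʳ y∉S u∈S w∈S (inj₁ (_ , w≡y)) = inside≢outside w∈S y∉S w≡y
  outside-¬Pairʳ y∉S u∈S w∈S (inj₂ (u≡y , _)) = inside≢outside u∈S y∉S u≡y

  degree≤Δ : ∀ G → Realizes G d → ∀ v → degree G v ≤ Δ
  degree≤Δ G r v = subst (_≤ Δ) (sym (r v)) (d≤Δ v)

  module Improve (G : SimpleGraph n) (r : Realizes G d) {s₁ s₂ t₁ t₂ : Fin n}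
    (s₁∈S : S s₁ ≡ true) (s₂∈S : S s₂ ≡ true) (s₁≢s₂ : ¬ s₁ ≡ s₂) (s₁s₂ : Adj G s₁ s₂ ≡ false)
    (s₁t₁ : Adj G s₁ t₁ ≡ true) (t₁∉S : S t₁ ≡ false) (s₂t₂ : Adj G s₂ t₂ ≡ true) (t₂∉S : S t₂ ≡ false)
    where

    -- The edge xy of the double switch must avoid all of these, so that both switches are legal
    -- and no edge inside S is removed.
    near-sets : List (Fin n → Bool)
    near-sets = S ∷ ⁅ t₁ ⁆ ∷ ⁅ t₂ ⁆ ∷ Adj G t₁ ∷ Adj G t₂ ∷ Adj G s₁ ∷ []

    count-near : count (⋃ near-sets) ≤ 4 * suc Δ
    count-near = begin
      count (⋃ near-sets)                          ≤⟨ count-⋃ near-sets ⟩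
      List.sum (map count near-sets)               ≤⟨ +-mono-≤ |S|≤ (+-mono-≤ (one t₁) (+-mono-≤ (one t₂)
                                                        (+-mono-≤ (deg t₁) (+-mono-≤ (deg t₂) (+-monoˡ-≤ 0 (deg s₁)))))) ⟩
      suc Δ + (1 + (1 + (Δ + (Δ + (Δ + 0)))))     ≤⟨ n≤1+n _ ⟩
      suc (suc Δ + (1 + (1 + (Δ + (Δ + (Δ + 0)))))) ≡⟨ solve 1 (λ Δ → con 1 :+ ((con 1 :+ Δ) :+ (con 1 :+ (con 1 :+ (Δ :+ (Δ :+ (Δ :+ con 0))))))
                                                             := con 4 :* (con 1 :+ Δ)) refl Δ ⟩
      4 * suc Δ                                    ∎
      where
      open ≤-Reasoning
      open +-*-Solver
      |S|≤ : count S ≤ suc Δ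
      |S|≤ = subst (_≤ suc Δ) (sym |S|) (s≤s k≤Δ)
      one : ∀ p → count ⁅ p ⁆ ≤ 1
      one p = ≤-reflexive (count-⁅⁆ p)
      deg : ∀ v → count (Adj G v) ≤ Δ
      deg v = subst (_≤ Δ) (degree-count G v) (degree≤Δ G r v)

    record Far (v : Fin n) : Set where
      field
        outside        : S v ≡ false
        ≢t₁            : ¬ v ≡ t₁
        ≢t₂            : ¬ v ≡ t₂
        t₁-nonadjacent : Adj G t₁ v ≡ false
        t₂-nonadjacent : Adj G t₂ v ≡ false
        s₁-nonadjacent : Adj G s₁ v ≡ false

    far : ∀ {v} → ⋃ near-sets v ≡ false → Far v
    far {v} v-far with ⋃-false near-sets v v-far
    ... | v∉S ∷ v≢t₁ ∷ v≢t₂ ∷ t₁v ∷ t₂v ∷ s₁v ∷ [] = record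
      { outside = v∉S ; ≢t₁ = ⁅⁆-false v≢t₁ ; ≢t₂ = ⁅⁆-false v≢t₂
      ; t₁-nonadjacent = t₁v ; t₂-nonadjacent = t₂v ; s₁-nonadjacent = s₁v }

    module DoubleSwitch {x y : Fin n} (yx : Adj G y x ≡ true) (y-far : Far y) (x-far : Far x) where

      open Far

      s₁≢x : ¬ s₁ ≡ x
      s₁≢x = inside≢outside s₁∈S (outside x-far)
      s₁≢y : ¬ s₁ ≡ y
      s₁≢y = inside≢outside s₁∈S (outside y-far)
      s₂≢x : ¬ s₂ ≡ x
      s₂≢x = inside≢outside s₂∈S (outside x-far)
      s₂≢y : ¬ s₂ ≡ y
      s₂≢y = inside≢outside s₂∈S (outside y-far)
      s₁≢t₁ : ¬ s₁ ≡ t₁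
      s₁≢t₁ = inside≢outside s₁∈S t₁∉S
      s₁≢t₂ : ¬ s₁ ≡ t₂
      s₁≢t₂ = inside≢outside s₁∈S t₂∉S
      s₂≢t₁ : ¬ s₂ ≡ t₁
      s₂≢t₁ = inside≢outside s₂∈S t₁∉S
      s₂≢t₂ : ¬ s₂ ≡ t₂
      s₂≢t₂ = inside≢outside s₂∈S t₂∉S
      x≢y : ¬ x ≡ y
      x≢y refl = true≢false (trans (sym yx) (SimpleGraph.irrefl G x))

      module SW₁ = Switch G (≢-sym s₁≢t₁) (≢-sym (≢t₁ x-far)) (≢-sym (≢t₁ y-far)) s₁≢x s₁≢y x≢y
                     (trans (SimpleGraph.sym G t₁ s₁) s₁t₁) (trans (SimpleGraph.sym G x y) yx)
                     (t₁-nonadjacent x-far) (s₁-nonadjacent y-far)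

      G₁ : SimpleGraph n
      G₁ = SW₁.switch

      untouched₁ : ∀ {u w} → (¬ u ≡ t₁ × ¬ u ≡ s₁ × ¬ u ≡ x × ¬ u ≡ y) → Adj G₁ u w ≡ Adj G u w
      untouched₁ (≢t₁ , ≢s₁ , ≢x , ≢y) =
        SW₁.Adj-switch (avoids ≢t₁ ≢s₁) (avoids ≢x ≢y) (avoids ≢t₁ ≢x) (avoids ≢s₁ ≢y)

      module SW₂ = Switch G₁ s₁≢y s₁≢s₂ s₁≢t₂ (≢-sym s₂≢y) (≢t₂ y-far) s₂≢t₂
                     SW₁.Adj-switch-be
                     (trans (untouched₁ (s₂≢t₁ , ≢-sym s₁≢s₂ , s₂≢x , s₂≢y)) s₂t₂)
                     (trans (SimpleGraph.sym G₁ s₁ s₂)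
                       (trans (untouched₁ (s₂≢t₁ , ≢-sym s₁≢s₂ , s₂≢x , s₂≢y)) (trans (SimpleGraph.sym G s₂ s₁) s₁s₂)))
                     -- t₂ may coincide with t₁, so the pair y t₂ is checked against each switched pair
                     (trans (SW₁.Adj-switch (avoids (≢t₁ y-far) (≢-sym s₁≢y)) (avoids′ (≢-sym (≢t₂ x-far)) (≢-sym (≢t₂ y-far)))
                                            (avoids (≢t₁ y-far) (≢-sym x≢y)) (avoids′ (≢-sym s₁≢t₂) (≢-sym (≢t₂ y-far))))
                       (trans (SimpleGraph.sym G y t₂) (t₂-nonadjacent y-far)))

      G₂ : SimpleGraph n
      G₂ = SW₂.switch

      realizes : Realizes G₂ d
      realizes v = trans (SW₂.degree-switch v) (trans (SW₁.degree-switch v) (r v))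

      keeps-inside-edge : ∀ {u w} → S u ≡ true → S w ≡ true → Adj G u w ≡ true → Adj G₂ u w ≡ true
      keeps-inside-edge u∈S w∈S uw =
        SW₂.switch-keeps-edge
          (SW₁.switch-keeps-edge uw (outside-¬Pairˡ t₁∉S u∈S w∈S) (outside-¬Pairˡ (outside x-far) u∈S w∈S))
          (outside-¬Pairʳ (outside y-far) u∈S w∈S) (outside-¬Pairʳ t₂∉S u∈S w∈S)

      fewer-missing : missing-pairs G₂ < missing-pairs G
      fewer-missing = count₂-< (missing? G₂) (missing? G) still-missing (s₁∈S , s₂∈S , s₁≢s₂ , s₁s₂)
        (λ (_ , _ , _ , s₁s₂′) → true≢false (trans (sym SW₂.Adj-switch-ac) s₁s₂′))
        where
        still-missing : ∀ {u w} → Missing G₂ u w → Missing G u w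
        still-missing (u∈S , w∈S , u≢w , uw₂) = u∈S , w∈S , u≢w , contraposeᵇ (keeps-inside-edge u∈S w∈S) uw₂


    improvement : ∃ λ G′ → Realizes G′ d × missing-pairs G′ < missing-pairs G
    improvement = through (far-edge G (⋃ near-sets) (degree≤Δ G r) (λ v → subst (0 <_) (sym (r v)) (d>0 v))
                                 (≤-<-trans (*-monoʳ-≤ (suc Δ) count-near) large))
      where
      through : (∃₂ λ x y → Adj G y x ≡ true × ⋃ near-sets y ≡ false × ⋃ near-sets x ≡ false) →
                ∃ λ G′ → Realizes G′ d × missing-pairs G′ < missing-pairs G
      through (x , y , yx , y-far , x-far) = G₂ , realizes , fewer-missing
        where open DoubleSwitch yx (far y-far) (far x-far)

  improve : ∀ G → Realizes G d → ∀ {s₁ s₂} → Missing G s₁ s₂ →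
            ∃ λ G′ → Realizes G′ d × missing-pairs G′ < missing-pairs G
  improve G r (s₁∈S , s₂∈S , s₁≢s₂ , s₁s₂) =
    let t₁ , s₁t₁ , t₁∉S = escape G r s₁∈S s₂∈S s₁≢s₂ s₁s₂
        t₂ , s₂t₂ , t₂∉S = escape G r s₂∈S s₁∈S (≢-sym s₁≢s₂) (trans (SimpleGraph.sym G _ _) s₁s₂)
    in Improve.improvement G r s₁∈S s₂∈S s₁≢s₂ s₁s₂ s₁t₁ t₁∉S s₂t₂ t₂∉S

  clique-realization : ∀ G → Realizes G d → ∃ λ G′ → Realizes G′ d × Clique G′
  clique-realization G r = descend G r (<-wellFounded (missing-pairs G))
    where
    descend : ∀ G → Realizes G d → Acc _<_ (missing-pairs G) → ∃ λ G′ → Realizes G′ d × Clique G′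
    descend G r (acc smaller) with missing-pairs G ℕ.≟ 0
    ... | yes none = G , r , no-missing⇒clique G none
    ... | no some =
      let _ , _ , missing = count₂-pos (missing? G) (n≢0⇒n>0 some)
          G′ , r′ , fewer = improve G r missing
      in descend G′ r′ (smaller fewer)

  not-forcibly-connected : ∀ G → Realizes G d → ¬ ForciblyConnected d
  not-forcibly-connected G r forced =
    let G′ , r′ , clique = clique-realization G r
    in clique-disconnected G′ r′ clique (forced G′ r′)

-- Degree sequences

-- Positions beyond n read the last entry, making d at_ a non-increasing sequence on all of ℕ.
clamp : ∀ {n} → ℕ → Fin (suc n)
clamp {n} j = fromℕ< (s≤s (m⊓n≤n j n))

toℕ-clamp : ∀ {n} {j} → j ≤ n → toℕ (clamp {n} j) ≡ j
toℕ-clamp {n} {j} j≤n = trans (toℕ-fromℕ< (s≤s (m⊓n≤n j n))) (m≤n⇒m⊓n≡m j≤n)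

clamp-mono : ∀ {n i j} → i ≤ j → toℕ (clamp {n} i) ≤ toℕ (clamp {n} j)
clamp-mono {n} {i} {j} i≤j =
  subst₂ _≤_ (sym (toℕ-fromℕ< (s≤s (m⊓n≤n i n)))) (sym (toℕ-fromℕ< (s≤s (m⊓n≤n j n)))) (⊓-monoˡ-≤ n i≤j)

_at_ : ∀ {n} → (Fin (suc n) → ℕ) → ℕ → ℕ
d at j = d (clamp j)

at-non-increasing : ∀ {n} {d : Fin (suc n) → ℕ} → NonIncreasing d → NonIncreasingℕ (d at_)
at-non-increasing non-increasing i≤j = non-increasing _ _ (clamp-mono i≤j)

EqualDegreeSet : ∀ {n} → (Fin n → ℕ) → ℕ → Set
EqualDegreeSet d k = ∃ λ S → count S ≡ suc k × (∀ {s} → S s ≡ true → d s ≡ k)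

consecutive-block : ∀ {n} (d : Fin (suc n) → ℕ) {i k} → i + k ≤ n →
                    (∀ {t} → t ≤ k → d at (i + t) ≡ k) → EqualDegreeSet d k
consecutive-block {n} d {i} {k} i+k≤n flat = image σ , count-image σ σ-injective , d-image
  where
  σ : Fin (suc k) → Fin (suc n)
  σ t = clamp (i + toℕ t)
  in-range : ∀ (t : Fin (suc k)) → i + toℕ t ≤ n
  in-range t = ≤-trans (+-monoʳ-≤ i (≤-pred (toℕ<n t))) i+k≤n
  σ-injective : ∀ {t t′} → σ t ≡ σ t′ → t ≡ t′
  σ-injective {t} {t′} σt≡σt′ = toℕ-injective (+-cancelˡ-≡ i _ _
    (trans (sym (toℕ-clamp (in-range t))) (trans (cong toℕ σt≡σt′) (toℕ-clamp (in-range t′)))))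
  d-image : ∀ {s} → image σ s ≡ true → d s ≡ k
  d-image s∈ with image-member σ s∈
  ... | t , refl = flat (≤-pred (toℕ<n t))

block-of-equal-degrees : ∀ {n} (d : Fin (suc n) → ℕ) → NonIncreasing d → (∀ v → 0 < d v) →
                         d zero * d zero ≤ n → ∃ λ k → EqualDegreeSet d k
block-of-equal-degrees {n} d non-increasing d>0 Δ*Δ≤n
  with long-plateau (d at_) (at-non-increasing non-increasing) (d zero) ≤-refl (d>0 _)
... | i , i+Δ≤Δ*Δ , flat = d at i ,
  consecutive-block d (≤-trans (+-monoʳ-≤ i k≤Δ) (≤-trans i+Δ≤Δ*Δ Δ*Δ≤n)) (λ t≤k → flat (≤-trans t≤k k≤Δ))
  where
  k≤Δ : d at i ≤ d zero
  k≤Δ = at-non-increasing non-increasing z≤n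

positive-degrees : ∀ {n} {d : Fin (suc (suc n)) → ℕ} (G : SimpleGraph (suc (suc n))) →
                   Realizes G d → ForciblyConnected d → ∀ v → 0 < d v
positive-degrees {d = d} G r forced v = neighbour-positive (reach-neighbour (forced G r (other v) v) (other≢ v))
  where
  other : ∀ {n} → Fin (suc (suc n)) → Fin (suc (suc n))
  other zero    = suc zero
  other (suc _) = zero
  other≢ : ∀ {n} (v : Fin (suc (suc n))) → ¬ other v ≡ v
  other≢ zero    ()
  other≢ (suc _) ()
  neighbour-positive : (∃ λ w → Adj G w v ≡ true) → 0 < d v
  neighbour-positive (w , wv) = subst (0 <_) (r v) (adjacent⇒degree>0 G (trans (SimpleGraph.sym G v w) wv))

square<⇒≤ : ∀ Δ N → suc Δ * (4 * suc Δ) < suc N → Δ * Δ ≤ N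
square<⇒≤ Δ N large = ≤-pred (≤-trans (s≤s (*-mono-≤ (n≤1+n Δ) (≤-trans (n≤1+n Δ) (m≤n*m (suc Δ) 4)))) large)

forcibly-connected⇒order-bound : ∀ {n} (d : Fin (suc (suc n)) → ℕ) → Graphical d → ForciblyConnected d →
                                 suc (suc n) ≤ suc (d zero) * (4 * suc (d zero))
forcibly-connected⇒order-bound {n} d (non-increasing , G , r) forced
  with suc (d zero) * (4 * suc (d zero)) <? suc (suc n)
... | no small  = ≮⇒≥ small
... | yes large =
  let d>0 = positive-degrees G r forced
      k , S , |S| , d-S = block-of-equal-degrees d non-increasing d>0 (square<⇒≤ (d zero) (suc n) large)
  in ⊥-elim (CliqueComponent.not-forcibly-connected d (λ v → non-increasing zero v z≤n) d>0 S |S| d-S large G r forced)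

quadratic-bound : ∀ Δ N → 0 < Δ → N ≤ suc Δ * (4 * suc Δ) → 1 * N < 17 * Δ ^ 2
quadratic-bound Δ N Δ>0 N≤ = begin-strict
  1 * N                                  ≡⟨ *-identityˡ N ⟩
  N                                      ≤⟨ N≤ ⟩
  suc Δ * (4 * suc Δ)                    ≤⟨ *-mono-≤ 1+Δ≤Δ+Δ (*-monoʳ-≤ 4 1+Δ≤Δ+Δ) ⟩
  (Δ + Δ) * (4 * (Δ + Δ))                <⟨ m<m+n _ (*-mono-≤ Δ>0 Δ>0) ⟩
  (Δ + Δ) * (4 * (Δ + Δ)) + Δ * Δ        ≡⟨ solve 1 (λ Δ → (Δ :+ Δ) :* (con 4 :* (Δ :+ Δ)) :+ Δ :* Δ := con 17 :* (Δ :^ 2)) refl Δ ⟩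
  17 * Δ ^ 2                             ∎
  where
  open ≤-Reasoning
  open +-*-Solver
  1+Δ≤Δ+Δ : suc Δ ≤ Δ + Δ
  1+Δ≤Δ+Δ = +-monoˡ-≤ Δ Δ>0

theorem1 : Σ ℕ λ a → Σ ℕ λ b → Σ ℕ λ N → (0 < a) × (0 < b) ×
    (∀ (n : ℕ) → 2 ≤ suc n → N ≤ suc n → (d : Fin (suc n) → ℕ) →
      Graphical d → ForciblyConnected d → a * suc n < b * (d zero ^ 2))
theorem1 = 1 , 17 , 0 , s≤s z≤n , s≤s z≤n , bound
  where
  bound : ∀ n → 2 ≤ suc n → 0 ≤ suc n → (d : Fin (suc n) → ℕ) →
          Graphical d → ForciblyConnected d → 1 * suc n < 17 * (d zero ^ 2)
  bound zero    (s≤s ()) _ _ _ _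
  bound (suc n) _ _ d graphical@(_ , G , r) forced =
    quadratic-bound (d zero) (suc (suc n)) (positive-degrees G r forced zero)
                    (forcibly-connected⇒order-bound d graphical forced)
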